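{- Let $k\geq 3$ and let $G_k$, $G_{k+1}$ be the graphs defined below (for $\ell=2$). Let $\varphi(0)=0$ and $\varphi(m)=m+2^k$ for nonzero nodes $m$ of $G_k$. Then $\varphi$ is a color-preserving graph isomorphism from $G_k$ onto $B_1$ of $G_{k+1}$; in addition, $G_{k+1}$ has a blue edge from $II_t^{k+1}$ to $I_b^{k+1}$.
   Context: The pruning function $\operatorname{P}_{2}:\mathbb{Z}_{>0}\to\mathbb{Z}_{\geq 0}$: write $m$ in binary, padded on the left with zeros as needed, let $z$ be the position (position $0$ = least significant bit) of the second zero bit counted from the right, let $q = 2^{z}\lfloor m/2^{z}\rfloor$, and set $\operatorname{P}_2(m)=\max(q-1,0)$. For an integer $k\ge 2$, $G_k$ is the directed graph with node set $\{0\}\cup\{2^{k-1}-1,\ldots,2^k-1\}$ and edges: for each $m$ with $2^{k-1}-1\le m<2^k-1$, a "blue" edge from $m$ to $m+1$ (weight $-1$) and a "red" edge from $\operatorname{P}_2(m)$ to $m$ (weight $+1$). For $k\ge 4$ set $I_t^k=2^k-1$, $I_b^k=2^k-2^{k-2}-1$, $II_t^k=2^k-2^{k-2}-2$, $II_b^k=2^k-2^{k-2}-2^{k-4}-1$, $III_t^k=2^k-2^{k-2}-2^{k-4}-2$, $III_b^k=2^k-2^{k-2}-2^{k-3}-1$, $IV_t^k=2^k-2^{k-2}-2^{k-3}-2$, $IV_b^k=2^{k-1}-1$. For $X\in\{I,II,III,IV\}$, the box $B_j$ ($j=1,2,3,4$ respectively) of $G_k$ is the induced subgraph of $G_k$ on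 $\{0\}\cup\{X_b^k,\ldots,X_t^k\}$. -}

module Defs where

open import Data.Nat using (ℕ; zero; suc; _+_; _*_; _∸_; _^_; _≤_; _<_)
open import Data.Nat.Properties using (m^n≢0)
open import Data.Nat.DivMod using (_/_; _%_)
open import Data.Product using (Σ; _×_; _,_)
open import Data.Sum using (_⊎_)
open import Relation.Binary.PropositionalEquality using (_≡_)

-- Position of the (j+1)-th zero bit (counted from the right, position 0 =
-- least significant bit) of m, in binary padded on the left by zeros.
-- Fuel-driven recursion; fuel m + 2 always suffices, since the bit length
-- L of m satisfies L ≤ m, and positions L and L+1 are zeros (so the second
-- zero is at position ≤ m + 1, reached after ≤ m + 2 steps).
zeroPosF : ℕ → ℕ → ℕ → ℕ
zeroPosF zero    j       m = 0
zeroPosF (suc f) j       m with m % 2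
zeroPosF (suc f) zero    m | zero = 0
zeroPosF (suc f) (suc j) m | zero = suc (zeroPosF f j (m / 2))
zeroPosF (suc f) j       m | suc _ = suc (zeroPosF f j (m / 2))

secondZero : ℕ → ℕ
secondZero m = zeroPosF (m + 2) 1 m

-- P₂(m) = max(2^z ⌊m / 2^z⌋ - 1, 0)   (truncated subtraction gives the max)
P₂ : ℕ → ℕ
P₂ m = (2 ^ z * ((m / 2 ^ z) {{m^n≢0 2 z}})) ∸ 1
  where z = secondZero m

data Color : Set where
  blue red : Color

Node : ℕ → ℕ → Set
Node k m = m ≡ 0 ⊎ ((2 ^ (k ∸ 1) ∸ 1 ≤ m) × (m ≤ 2 ^ k ∸ 1))

Edge : ℕ → Color → ℕ → ℕ → Set
Edge k blue u v = ((2 ^ (k ∸ 1) ∸ 1 ≤ u) × (u < 2 ^ k ∸ 1)) × (v ≡ suc u)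
Edge k red  u v = ((2 ^ (k ∸ 1) ∸ 1 ≤ v) × (v < 2 ^ k ∸ 1)) × (u ≡ P₂ v)

I-t : ℕ → ℕ
I-t k = 2 ^ k ∸ 1

I-b : ℕ → ℕ
I-b k = 2 ^ k ∸ 2 ^ (k ∸ 2) ∸ 1

II-t : ℕ → ℕ
II-t k = 2 ^ k ∸ 2 ^ (k ∸ 2) ∸ 2

B₁Node : ℕ → ℕ → Set
B₁Node k m = m ≡ 0 ⊎ ((I-b k ≤ m) × (m ≤ I-t k))

B₁Edge : ℕ → Color → ℕ → ℕ → Set
B₁Edge k c u v = Edge k c u v × B₁Node k u × B₁Node k v

φ : ℕ → ℕ → ℕ
φ k zero    = 0
φ k (suc m) = suc m + 2 ^ k

record IsColourIso (N₁ : ℕ → Set) (E₁ : Color → ℕ → ℕ → Set)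
                   (N₂ : ℕ → Set) (E₂ : Color → ℕ → ℕ → Set)
                   (f : ℕ → ℕ) : Set where
  field
    maps-nodes : ∀ m → N₁ m → N₂ (f m)
    injective  : ∀ m n → N₁ m → N₁ n → f m ≡ f n → m ≡ n
    surjective : ∀ n → N₂ n → Σ ℕ (λ m → N₁ m × f m ≡ n)
    preserves  : ∀ c u v → N₁ u → N₁ v → E₁ c u v → E₂ c (f u) (f v)
    reflects   : ∀ c u v → N₁ u → N₁ v → E₂ c (f u) (f v) → E₁ c u v

-- Adding 2^k to m < 2^k only switches on bit k, which was zero.  If the
-- second zero z of m lies below k it does not move, and P₂ moves by 2^k along
-- with m; this needs 2^z ≤ m, which holds on the nodes of G_k because the
-- only node below 2^(k-1), namely 2^(k-1) - 1, has z = k.  If z ≥ k, the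
-- second zero of m + 2^k lies above k and both P₂ values are 0 = φ 0.  So φ
-- commutes with P₂ on red edges, blue edges commute with any translation, and
-- the interval [2^(k-1) - 1, 2^k - 1] is translated exactly onto B₁ of G_(k+1).
module Submission where

open import Defs
open import Data.Nat
open import Data.Nat.Properties
open import Data.Nat.DivMod
open import Data.Nat.Divisibility using (n∣m*n)
open import Data.Nat.Tactic.RingSolver using (solve-∀)
open import Data.Product using (Σ; _×_; _,_)
open import Data.Sum using (inj₁; inj₂)
open import Relation.Nullary using (yes; no; contradiction)
open import Relation.Binary.PropositionalEquality

n<2^n : ∀ n → n < 2 ^ n
n<2^n zero    = z<s
n<2^n (suc n) = +-mono-≤ (m^n>0 2 n) (≤-trans (n<2^n n) (m≤m+n (2 ^ n) 0))

2^suc≡2^+2^ : ∀ n → 2 ^ suc n ≡ 2 ^ n + 2 ^ n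
2^suc≡2^+2^ n = cong (2 ^ n +_) (+-identityʳ (2 ^ n))

[m+kn]/n≡m/n+k : ∀ m k n .{{_ : NonZero n}} → (m + k * n) / n ≡ m / n + k
[m+kn]/n≡m/n+k m k n = trans (+-distrib-/-∣ʳ m (n∣m*n k)) (cong (m / n +_) (m*n/n≡m k n))

zeroPosStep : ℕ → ℕ → ℕ → ℕ → ℕ
zeroPosStep f (suc _) j       h = suc (zeroPosF f j h)
zeroPosStep f zero    zero    h = 0
zeroPosStep f zero    (suc j) h = suc (zeroPosF f j h)

zeroPosF-suc : ∀ f j m → zeroPosF (suc f) j m ≡ zeroPosStep f (m % 2) j (m / 2)
zeroPosF-suc f j m with m % 2
zeroPosF-suc f zero    m | zero  = refl
zeroPosF-suc f (suc j) m | zero  = refl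
zeroPosF-suc f j       m | suc _ = refl

zeroPosF-suc-+*2 : ∀ f j m c →
                   zeroPosF (suc f) j (m + c * 2) ≡ zeroPosStep f (m % 2) j (m / 2 + c)
zeroPosF-suc-+*2 f j m c = trans (zeroPosF-suc f j (m + c * 2))
  (cong₂ (λ b h → zeroPosStep f b j h) ([m+kn]%n≡m%n m c 2) ([m+kn]/n≡m/n+k m c 2))

zeroPosF-suc-+2^ : ∀ f j m k →
                   zeroPosF (suc f) j (m + 2 ^ suc k) ≡ zeroPosStep f (m % 2) j (m / 2 + 2 ^ k)
zeroPosF-suc-+2^ f j m k = trans (cong (λ x → zeroPosF (suc f) j (m + x)) (*-comm 2 (2 ^ k)))
                                 (zeroPosF-suc-+*2 f j m (2 ^ k))

zeroPosF-+2^-below : ∀ k f f' j m → zeroPosF f j m < k → k ≤ f → k ≤ f' →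
                     zeroPosF f' j (m + 2 ^ k) ≡ zeroPosF f j m
zeroPosF-+2^-below (suc k) (suc f) (suc f') j m z<k (s≤s k≤f) (s≤s k≤f') = begin
  zeroPosF (suc f') j (m + 2 ^ suc k)       ≡⟨ zeroPosF-suc-+2^ f' j m k ⟩
  zeroPosStep f' (m % 2) j (m / 2 + 2 ^ k)  ≡⟨ step (m % 2) j step<k ⟩
  zeroPosStep f (m % 2) j (m / 2)           ≡⟨ zeroPosF-suc f j m ⟨
  zeroPosF (suc f) j m                      ∎
  where
  open ≡-Reasoning
  step<k : zeroPosStep f (m % 2) j (m / 2) < suc k
  step<k = subst (_< suc k) (zeroPosF-suc f j m) z<k
  ih : ∀ j → zeroPosF f j (m / 2) < k → zeroPosF f' j (m / 2 + 2 ^ k) ≡ zeroPosF f j (m / 2)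
  ih j z<k = zeroPosF-+2^-below k f f' j (m / 2) z<k k≤f k≤f'
  step : ∀ b j → zeroPosStep f b j (m / 2) < suc k →
         zeroPosStep f' b j (m / 2 + 2 ^ k) ≡ zeroPosStep f b j (m / 2)
  step (suc _) j       z<k = cong suc (ih j (≤-pred z<k))
  step zero    zero    _   = refl
  step zero    (suc j) z<k = cong suc (ih j (≤-pred z<k))

zeroPosF-+2^-above : ∀ k f f' j m → m < 2 ^ k → k ≤ zeroPosF f j m → suc k ≤ f' →
                     suc k ≤ zeroPosF f' j (m + 2 ^ k)
zeroPosF-+2^-above zero f (suc f') j zero    _        _ _ = z<s
zeroPosF-+2^-above zero f f'       j (suc m) (s≤s ()) _ _
zeroPosF-+2^-above (suc k) (suc f) (suc f') j m m<2^k k≤z (s≤s k≤f') =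
  subst (suc (suc k) ≤_) (sym (zeroPosF-suc-+2^ f' j m k))
    (step (m % 2) j (subst (suc k ≤_) (zeroPosF-suc f j m) k≤z))
  where
  half<2^k : m / 2 < 2 ^ k
  half<2^k = m<n*o⇒m/o<n (subst (m <_) (*-comm 2 (2 ^ k)) m<2^k)
  ih : ∀ j → k ≤ zeroPosF f j (m / 2) → suc k ≤ zeroPosF f' j (m / 2 + 2 ^ k)
  ih j k≤z = zeroPosF-+2^-above k f f' j (m / 2) half<2^k k≤z k≤f'
  step : ∀ b j → suc k ≤ zeroPosStep f b j (m / 2) →
         suc (suc k) ≤ zeroPosStep f' b j (m / 2 + 2 ^ k)
  step (suc _) j       k≤z = s≤s (ih j (≤-pred k≤z))
  step zero    (suc j) k≤z = s≤s (ih j (≤-pred k≤z))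

2^suc∸1≡1+[2^∸1]*2 : ∀ z → 2 ^ suc z ∸ 1 ≡ 1 + (2 ^ z ∸ 1) * 2
2^suc∸1≡1+[2^∸1]*2 z = trans (cong (λ n → 2 * n ∸ 1) (sym (m+[n∸m]≡n (m^n>0 2 z))))
                             (double (2 ^ z ∸ 1))
  where
  double : ∀ x → x + (suc x + 0) ≡ 1 + x * 2
  double = solve-∀

zeroPosF-allOnes : ∀ z f → suc z ≤ f → suc z ≤ zeroPosF f 1 (2 ^ z ∸ 1)
zeroPosF-allOnes zero    (suc f) _ = s≤s z≤n
zeroPosF-allOnes (suc z) (suc f) (s≤s z<f) =
  subst (suc (suc z) ≤_) (sym (trans (cong (zeroPosF (suc f) 1) (2^suc∸1≡1+[2^∸1]*2 z))
                                     (zeroPosF-suc-+*2 f 1 1 (2 ^ z ∸ 1))))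
    (s≤s (zeroPosF-allOnes z f z<f))

zeroPosF-1-pos : ∀ f m → 1 ≤ zeroPosF (suc f) 1 m
zeroPosF-1-pos f m with m % 2
... | zero  = s≤s z≤n
... | suc _ = s≤s z≤n

secondZero-pos : ∀ m → 1 ≤ secondZero m
secondZero-pos m = subst (λ f → 1 ≤ zeroPosF f 1 m) (+-comm 2 m) (zeroPosF-1-pos (suc m) m)

secondZero-allOnes : ∀ K → suc K ≤ secondZero (2 ^ K ∸ 1)
secondZero-allOnes K = zeroPosF-allOnes K (2 ^ K ∸ 1 + 2) fuel
  where
  fuel : suc K ≤ 2 ^ K ∸ 1 + 2
  fuel = ≤-trans (n<2^n K)
           (≤-trans (≤-reflexive (sym (m∸n+n≡m (m^n>0 2 K))))
                    (+-monoʳ-≤ (2 ^ K ∸ 1) (n≤1+n 1)))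

k<m+2^k+2 : ∀ k m → k < m + 2 ^ k + 2
k<m+2^k+2 k m = ≤-trans (n<2^n k) (≤-trans (m≤n+m (2 ^ k) m) (m≤m+n (m + 2 ^ k) 2))

secondZero-+2^-below : ∀ k m → k ≤ m + 2 → secondZero m < k →
                       secondZero (m + 2 ^ k) ≡ secondZero m
secondZero-+2^-below k m k≤m+2 z<k =
  zeroPosF-+2^-below k (m + 2) (m + 2 ^ k + 2) 1 m z<k k≤m+2 (<⇒≤ (k<m+2^k+2 k m))

secondZero-+2^-above : ∀ k m → m < 2 ^ k → k ≤ secondZero m →
                       suc k ≤ secondZero (m + 2 ^ k)
secondZero-+2^-above k m m<2^k k≤z =
  zeroPosF-+2^-above k (m + 2) (m + 2 ^ k + 2) 1 m m<2^k k≤z (k<m+2^k+2 k m)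

-- P₂ m = roundDownPred (secondZero m) m definitionally.
roundDownPred : ℕ → ℕ → ℕ
roundDownPred z m = 2 ^ z * ((m / 2 ^ z) {{m^n≢0 2 z}}) ∸ 1

roundDownPred-< : ∀ z m → m < 2 ^ z → roundDownPred z m ≡ 0
roundDownPred-< z m m<2^z = trans (cong (λ q → 2 ^ z * q ∸ 1) (m<n⇒m/n≡0 {{m^n≢0 2 z}} m<2^z))
                                  (cong (_∸ 1) (*-zeroʳ (2 ^ z)))

φ-∸1 : ∀ k q → 2 ≤ q → q + 2 ^ k ∸ 1 ≡ φ k (q ∸ 1)
φ-∸1 k (suc (suc q)) _         = refl
φ-∸1 k (suc zero)    (s≤s ())

roundDownPred-+2^ : ∀ k z m → 1 ≤ z → z ≤ k → 2 ^ z ≤ m →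
                    roundDownPred z (m + 2 ^ k) ≡ φ k (roundDownPred z m)
roundDownPred-+2^ k z m 1≤z z≤k 2^z≤m = begin
  d * ((m + 2 ^ k) / d) ∸ 1     ≡⟨ cong (λ x → d * ((m + x) / d) ∸ 1) 2^k≡c*d ⟩
  d * ((m + c * d) / d) ∸ 1     ≡⟨ cong (λ x → d * x ∸ 1) ([m+kn]/n≡m/n+k m c d) ⟩
  d * (m / d + c) ∸ 1           ≡⟨ cong (_∸ 1) (*-distribˡ-+ d (m / d) c) ⟩
  d * (m / d) + d * c ∸ 1       ≡⟨ cong (λ x → d * (m / d) + x ∸ 1) (*-comm d c) ⟩
  d * (m / d) + c * d ∸ 1       ≡⟨ cong (λ x → d * (m / d) + x ∸ 1) 2^k≡c*d ⟨
  d * (m / d) + 2 ^ k ∸ 1       ≡⟨ φ-∸1 k (d * (m / d)) 2≤q ⟩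
  φ k (d * (m / d) ∸ 1)         ∎
  where
  open ≡-Reasoning
  d c : ℕ
  d = 2 ^ z
  c = 2 ^ (k ∸ z)
  instance
    _ : NonZero d
    _ = m^n≢0 2 z
  2^k≡c*d : 2 ^ k ≡ c * d
  2^k≡c*d = trans (cong (2 ^_) (sym (m∸n+n≡m z≤k))) (^-distribˡ-+-* 2 (k ∸ z) z)
  2≤q : 2 ≤ d * (m / d)
  2≤q = *-mono-≤ (^-monoʳ-≤ 2 1≤z) (m≥n⇒m/n>0 2^z≤m)

2^secondZero≤ : ∀ K m → 2 ^ K ∸ 1 ≤ m → secondZero m ≤ K → 2 ^ secondZero m ≤ m
2^secondZero≤ K m lo z≤K with 2 ^ K ∸ 1 ≟ m
... | yes refl = contradiction (≤-trans (secondZero-allOnes K) z≤K) (n≮n K)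
... | no ≢m    = ≤-trans (^-monoʳ-≤ 2 z≤K)
                   (subst (_≤ m) (m+[n∸m]≡n (m^n>0 2 K)) (≤∧≢⇒< lo ≢m))

P₂-+2^-low : ∀ K m → 2 ^ K ∸ 1 ≤ m → secondZero m ≤ K →
             P₂ (m + 2 ^ suc K) ≡ φ (suc K) (P₂ m)
P₂-+2^-low K m lo z≤K = begin
  roundDownPred (secondZero (m + 2 ^ suc K)) (m + 2 ^ suc K)
    ≡⟨ cong (λ z → roundDownPred z (m + 2 ^ suc K))
            (secondZero-+2^-below (suc K) m k≤m+2 (s≤s z≤K)) ⟩
  roundDownPred (secondZero m) (m + 2 ^ suc K)
    ≡⟨ roundDownPred-+2^ (suc K) (secondZero m) m (secondZero-pos m) (m≤n⇒m≤1+n z≤K)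
                         (2^secondZero≤ K m lo z≤K) ⟩
  φ (suc K) (P₂ m) ∎
  where
  open ≡-Reasoning
  k≤m+2 : suc K ≤ m + 2
  k≤m+2 = ≤-trans (m<m+n K z<s) (+-monoˡ-≤ 2 (≤-trans (∸-monoˡ-≤ 1 (n<2^n K)) lo))

P₂-+2^-high : ∀ k m → m < 2 ^ k → k ≤ secondZero m → P₂ (m + 2 ^ k) ≡ φ k (P₂ m)
P₂-+2^-high k m m<2^k k≤z = begin
  P₂ (m + 2 ^ k) ≡⟨ roundDownPred-< (secondZero (m + 2 ^ k)) (m + 2 ^ k) m+2^k<2^z' ⟩
  0              ≡⟨ cong (φ k) (roundDownPred-< (secondZero m) m m<2^z) ⟨
  φ k (P₂ m)     ∎
  where
  open ≡-Reasoning
  m<2^z : m < 2 ^ secondZero m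
  m<2^z = <-≤-trans m<2^k (^-monoʳ-≤ 2 k≤z)
  m+2^k<2^z' : m + 2 ^ k < 2 ^ secondZero (m + 2 ^ k)
  m+2^k<2^z' = <-≤-trans (subst (m + 2 ^ k <_) (sym (2^suc≡2^+2^ k)) (+-monoˡ-< (2 ^ k) m<2^k))
                         (^-monoʳ-≤ 2 (secondZero-+2^-above k m m<2^k k≤z))

P₂-φ : ∀ K v → 2 ^ K ∸ 1 ≤ suc v → suc v < 2 ^ suc K →
       P₂ (φ (suc K) (suc v)) ≡ φ (suc K) (P₂ (suc v))
P₂-φ K v lo hi with secondZero (suc v) ≤? K
... | yes z≤K = P₂-+2^-low K (suc v) lo z≤K
... | no  z≰K = P₂-+2^-high (suc K) (suc v) hi (≰⇒> z≰K)

φ-injective : ∀ k m n → φ k m ≡ φ k n → m ≡ n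
φ-injective k zero    zero    _ = refl
φ-injective k (suc m) (suc n) e = +-cancelʳ-≡ (2 ^ k) (suc m) (suc n) e

2^[2+K]∸2^K : ∀ K → 2 ^ suc (suc K) ∸ 2 ^ K ≡ 2 ^ K + 2 ^ suc K
2^[2+K]∸2^K K = trans (cong (_∸ 2 ^ K) (quadruple (2 ^ K)))
                      (m+n∸n≡m (2 ^ K + 2 ^ suc K) (2 ^ K))
  where
  quadruple : ∀ a → 2 * (2 * a) ≡ a + 2 * a + a
  quadruple = solve-∀

I-b-suc-suc : ∀ K → I-b (suc (suc K)) ≡ 2 ^ K ∸ 1 + 2 ^ suc K
I-b-suc-suc K = trans (cong (_∸ 1) (2^[2+K]∸2^K K)) (+-∸-comm (2 ^ suc K) (m^n>0 2 K))

I-t-suc-suc : ∀ K → I-t (suc (suc K)) ≡ 2 ^ suc K ∸ 1 + 2 ^ suc K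
I-t-suc-suc K = trans (cong (_∸ 1) (2^suc≡2^+2^ (suc K)))
                      (+-∸-comm (2 ^ suc K) (m^n>0 2 (suc K)))

m∸1≡1+[m∸2] : ∀ {m} → 2 ≤ m → m ∸ 1 ≡ suc (m ∸ 2)
m∸1≡1+[m∸2] (s≤s (s≤s _)) = refl

II-t⟶I-b : ∀ K → Edge (suc (suc K)) blue (II-t (suc (suc K))) (I-b (suc (suc K)))
II-t⟶I-b K = (lower , upper) , m∸1≡1+[m∸2] 2≤X
  where
  X : ℕ
  X = 2 ^ suc (suc K) ∸ 2 ^ K
  2≤X : 2 ≤ X
  2≤X = subst (2 ≤_) (sym (2^[2+K]∸2^K K)) (+-mono-≤ (m^n>0 2 K) (m^n>0 2 (suc K)))
  1+2^[1+K]≤X : suc (2 ^ suc K) ≤ X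
  1+2^[1+K]≤X = subst (suc (2 ^ suc K) ≤_) (sym (2^[2+K]∸2^K K))
                      (+-monoˡ-≤ (2 ^ suc K) (m^n>0 2 K))
  lower : 2 ^ suc K ∸ 1 ≤ X ∸ 2
  lower = ∸-monoˡ-≤ 2 1+2^[1+K]≤X
  upper : X ∸ 2 < 2 ^ suc (suc K) ∸ 1
  upper = subst (_≤ 2 ^ suc (suc K) ∸ 1) (m∸1≡1+[m∸2] 2≤X)
                (∸-monoˡ-≤ 1 (m∸n≤m (2 ^ suc (suc K)) (2 ^ K)))

module _ (K : ℕ) (0<2^K∸1 : 0 < 2 ^ K ∸ 1) where

  private
    k d : ℕ
    k = suc K
    d = 2 ^ k

  0<2^k∸1 : 0 < 2 ^ k ∸ 1
  0<2^k∸1 = ≤-trans 0<2^K∸1 (∸-monoˡ-≤ 1 (^-monoʳ-≤ 2 (n≤1+n K)))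

  Node-lower : ∀ v → Node k (suc v) → 2 ^ K ∸ 1 ≤ suc v
  Node-lower v (inj₂ (lo , _)) = lo

  φ-maps-nodes : ∀ m → Node k m → B₁Node (suc k) (φ k m)
  φ-maps-nodes zero    _               = inj₁ refl
  φ-maps-nodes (suc v) (inj₂ (lo , hi)) =
    inj₂ ( subst (_≤ suc v + d) (sym (I-b-suc-suc K)) (+-monoˡ-≤ d lo)
         , subst (suc v + d ≤_) (sym (I-t-suc-suc K)) (+-monoˡ-≤ d hi))

  φ-surjective : ∀ n → B₁Node (suc k) n → Σ ℕ (λ m → Node k m × φ k m ≡ n)
  φ-surjective n (inj₁ refl)      = 0 , inj₁ refl , refl
  φ-surjective n (inj₂ (lo , hi)) = n ∸ d , inj₂ (lo' , hi') , φ[n∸d]≡n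
    where
    lo' : 2 ^ K ∸ 1 ≤ n ∸ d
    lo' = m+n≤o⇒m≤o∸n (2 ^ K ∸ 1) (subst (_≤ n) (I-b-suc-suc K) lo)
    hi' : n ∸ d ≤ 2 ^ k ∸ 1
    hi' = m≤n+o⇒m∸n≤o n d (subst (n ≤_) (trans (I-t-suc-suc K) (+-comm (2 ^ k ∸ 1) d)) hi)
    d≤n : d ≤ n
    d≤n = ≤-trans (m≤n+m d (2 ^ K ∸ 1)) (subst (_≤ n) (I-b-suc-suc K) lo)
    φ[n∸d]≡n : φ k (n ∸ d) ≡ n
    φ[n∸d]≡n with n ∸ d in eq
    ... | zero  = contradiction (≤-trans 0<2^K∸1 (subst (2 ^ K ∸ 1 ≤_) eq lo')) λ ()
    ... | suc _ = trans (cong (_+ d) (sym eq)) (m∸n+n≡m d≤n)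

  shift-range : ∀ u → u < 2 ^ k ∸ 1 → (2 ^ k ∸ 1 ≤ u + d) × (u + d < 2 ^ suc k ∸ 1)
  shift-range u hi = ≤-trans (m∸n≤m d 1) (m≤n+m d u)
                   , subst (suc u + d ≤_) (sym (I-t-suc-suc K)) (+-monoˡ-≤ d hi)

  unshift-range : ∀ u → u + d < 2 ^ suc k ∸ 1 → u < 2 ^ k ∸ 1
  unshift-range u hi = +-cancelʳ-< d u (2 ^ k ∸ 1) (subst (u + d <_) (I-t-suc-suc K) hi)

  φ-preserves : ∀ c u v → Node k u → Node k v → Edge k c u v →
                B₁Edge (suc k) c (φ k u) (φ k v)
  φ-preserves blue zero    _ _  _  ((lo , _) , _) = contradiction lo (<⇒≱ 0<2^K∸1)
  φ-preserves blue (suc u) _ nu nv ((_ , hi) , refl) =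
    (shift-range (suc u) hi , refl) , φ-maps-nodes _ nu , φ-maps-nodes _ nv
  φ-preserves red  u zero    _  _  ((lo , _) , _) = contradiction lo (<⇒≱ 0<2^K∸1)
  φ-preserves red  u (suc v) nu nv ((lo , hi) , refl) =
    (shift-range (suc v) hi , sym (P₂-φ K v lo (<-≤-trans hi (m∸n≤m d 1))))
    , φ-maps-nodes _ nu , φ-maps-nodes _ nv

  φ-reflects : ∀ c u v → Node k u → Node k v → B₁Edge (suc k) c (φ k u) (φ k v) →
               Edge k c u v
  φ-reflects blue zero    _       _  _ (((lo , _) , _) , _) = contradiction lo (<⇒≱ 0<2^k∸1)
  φ-reflects blue (suc u) zero    _  _ ((_ , ()) , _)
  φ-reflects blue (suc u) (suc v) nu _ (((_ , hi) , e) , _) =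
    (Node-lower u nu , unshift-range (suc u) hi)
    , cong suc (+-cancelʳ-≡ d v (suc u) (suc-injective e))
  φ-reflects red  u       zero    _  _ (((lo , _) , _) , _) = contradiction lo (<⇒≱ 0<2^k∸1)
  φ-reflects red  u       (suc v) _ nv (((_ , hi) , e) , _) =
    (lo , hi') , φ-injective k u (P₂ (suc v)) (trans e (P₂-φ K v lo (<-≤-trans hi' (m∸n≤m d 1))))
    where
    lo : 2 ^ K ∸ 1 ≤ suc v
    lo = Node-lower v nv
    hi' : suc v < 2 ^ k ∸ 1
    hi' = unshift-range (suc v) hi

  φ-isColourIso : IsColourIso (Node k) (Edge k) (B₁Node (suc k)) (B₁Edge (suc k)) (φ k)
  φ-isColourIso = record
    { maps-nodes = φ-maps-nodes
    ; injective  = λ m n _ _ → φ-injective k m n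
    ; surjective = φ-surjective
    ; preserves  = φ-preserves
    ; reflects   = φ-reflects
    }

mainTheorem12 : (k : ℕ) → 3 ≤ k →
    IsColourIso (Node k) (Edge k) (B₁Node (suc k)) (B₁Edge (suc k)) (φ k)
    × Edge (suc k) blue (II-t (suc k)) (I-b (suc k))
mainTheorem12 (suc K) (s≤s 2≤K) = φ-isColourIso K 0<2^K∸1 , II-t⟶I-b K
  where
  0<2^K∸1 : 0 < 2 ^ K ∸ 1
  0<2^K∸1 = ∸-monoˡ-≤ 1 (^-monoʳ-≤ 2 (≤-trans (n≤1+n 1) 2≤K))
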